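{- Let $A_k(x)=\sum_{\pi\in\mathfrak{S}_k}x^{\mathrm{des}(\pi)}$ be the Eulerian polynomials, and define the binomial-Eulerian polynomials by $\widetilde{A}_0(x)=1$ and $\widetilde{A}_n(x)=1+x\sum_{k=1}^{n}\binom{n}{k}A_k(x)$ for $n\ge 1$. Write $\widetilde{A}_n(x)=\sum_{k}\widetilde{A}(n,k)x^k$, with $\widetilde{A}(n,k)=0$ for $k<0$ or $k>n$. Then for every $n\ge 1$ and every integer $k$, $$\widetilde{A}(n+1,k)=(k+1)\widetilde{A}(n,k)+(n-k+2)\widetilde{A}(n,k-1)-n\,\widetilde{A}(n-1,k-1).$$
   Context: $\mathfrak{S}_m$ is the symmetric group on $[m]=\{1,\dots,m\}$; permutations are written as words $\pi(1)\pi(2)\cdots\pi(m)$. $\mathrm{des}(\pi)$ is the number of indices $i\in[m-1]$ with $\pi(i)>\pi(i+1)$. -}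

module Defs where

open import Data.Nat using (ℕ; zero; suc; _≡ᵇ_)
open import Data.Nat.Properties using (_≟_)
open import Data.Nat.Combinatorics using (_C_)
open import Data.Bool using (if_then_else_)
open import Data.Integer using (ℤ; +_; -[1+_]; _+_; _*_)
open import Data.List using (List; []; _∷_; map; concatMap; filter; foldr; upTo; applyUpTo)
open import Data.List.Relation.Unary.Unique.DecPropositional _≟_ using (unique?)

-- Polynomials with integer coefficients, represented by their
-- coefficient function: p j = coefficient of x^j.

Poly : Set
Poly = ℕ → ℤ

0ₚ : Poly
0ₚ _ = + 0

mono : ℕ → Poly
mono d j = if j ≡ᵇ d then + 1 else + 0

1ₚ : Poly
1ₚ = mono 0

_⊕_ : Poly → Poly → Poly
(p ⊕ q) j = p j + q j

_·ₚ_ : ℕ → Poly → Poly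
(c ·ₚ p) j = + c * p j

xmul : Poly → Poly
xmul p zero    = + 0
xmul p (suc j) = p j

sumₚ : List Poly → Poly
sumₚ = foldr _⊕_ 0ₚ

-- The symmetric group 𝔖_m, as the list of words π(1)π(2)…π(m):
-- all words of length m with letters in [m] = {1,…,m} having no
-- repeated letter (i.e. exactly the bijections [m] → [m]).

words : ℕ → ℕ → List (List ℕ)
words m zero      = [] ∷ []
words m (suc len) = concatMap (λ w → map (λ a → a ∷ w) (applyUpTo suc m)) (words m len)

perms : ℕ → List (List ℕ)
perms m = filter unique? (words m m)

des : List ℕ → ℕ
des []            = 0
des (a ∷ [])      = 0
des (a ∷ b ∷ w)   = (if b Data.Nat.<ᵇ a then 1 else 0) Data.Nat.+ des (b ∷ w)

eulerian : ℕ → Poly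
eulerian k = sumₚ (map (λ π → mono (des π)) (perms k))

binEulerian : ℕ → Poly
binEulerian zero = 1ₚ
binEulerian n@(suc _) =
  1ₚ ⊕ xmul (sumₚ (map (λ k → (n C k) ·ₚ eulerian k) (applyUpTo suc n)))

coeff : Poly → ℤ → ℤ
coeff p (+ j)     = p j
coeff p -[1+ _ ]  = + 0

Ã : ℕ → ℤ → ℤ
Ã n k = coeff (binEulerian n) k

-- Inserting the letter k+1 into a permutation of [k] with d descents keeps d descents
-- when it goes into a descent or at the end (d+1 slots) and creates one more in the
-- other k-d slots; coefficientwise, A(k+1,j) = (j+1) A(k,j) + (k+1-j) A(k,j-1).
-- With B_n = Σ_k C(n,k) A_k one has Ã_n = 1 + x (B_n - 1).  Pascal's rule and the
-- absorption identity (k+1) C(n+1,k+1) = (n+1) C(n,k) turn the Eulerian recurrence into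
--   B(n+2,j) = (j+2) B(n+1,j) + (n+2-j) B(n+1,j-1) - (n+1) B(n,j-1),
-- and substituting B_n back into Ã_n gives the recurrence, one coefficient at a time.
module Submission where

open import Defs
open import Data.Nat as ℕ using (ℕ; zero; suc; _≤_; _<_; _∸_; _<ᵇ_; z≤n; s≤s)
open import Data.Nat.Combinatorics using (_C_; nC1≡n; nCk+nC[k+1]≡[n+1]C[k+1])
open import Data.Nat.Combinatorics.Specification using (k>n⇒nCk≡0)
open import Data.Nat.Properties as ℕ using (_<?_; <ᵇ-reflects-<; <⇒≱; <⇒≤; ≮⇒≥)
open import Data.Nat.Tactic.RingSolver using () renaming (solve-∀ to ℕ-solve-∀)
open import Data.Bool using (true; false)
open import Data.Fin using (toℕ; inject₁; fromℕ)
open import Data.Fin.Properties using (toℕ-inject₁; toℕ-fromℕ)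
open import Data.Integer using (ℤ; +_; -[1+_]; _+_; _-_; _*_)
open import Data.Integer.Properties as ℤ using (+-identityˡ; +-identityʳ; +-assoc)
open import Data.Integer.Tactic.RingSolver using (solve-∀)
open import Algebra.Properties.Semiring.Sum ℤ.+-*-semiring
  using (sum-syntax; sum⁺-syntax; sum-cong-≗; ∑-distrib-+; *-distribˡ-sum; sum-init-last)
open import Data.List using (List; []; _∷_; _++_; map; concatMap; length; applyUpTo; filter)
open import Data.List.Properties
  using (map-∘; map-id; filter-++; filter-all; filter-reject; ∷-injectiveˡ; ∷-injectiveʳ;
         length-filter; length-applyUpTo)
open import Data.List.Membership.DecPropositional ℕ._≟_ using (_∈?_)
open import Data.List.Membership.Propositional using (_∈_; _∉_; find; lose)
open import Data.List.Membership.Propositional.Properties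
  using (∈-map⁺; ∈-map⁻; ∈-concatMap⁺; ∈-concatMap⁻; ∈-applyUpTo⁺; ∈-applyUpTo⁻;
         ∈-filter⁺; ∈-filter⁻; ∈-∃++)
open import Data.List.Membership.Propositional.Properties.WithK using (unique∧set⇒bag)
open import Data.List.Relation.Binary.BagAndSetEquality using (∼bag⇒↭)
open import Data.List.Relation.Binary.Disjoint.Propositional using (Disjoint)
open import Data.List.Relation.Binary.Permutation.Propositional as ↭ using (_↭_; ↭-sym; ↭⇒↭ₛ)
open import Data.List.Relation.Binary.Permutation.Propositional.Properties
  using (↭-length; ∈-resp-↭) renaming (shift to ↭-shift)
open import Data.List.Relation.Unary.All as All using (All; []; _∷_)
open import Data.List.Relation.Unary.All.Properties using (¬Any⇒All¬; ++⁻ˡ; ++⁻ʳ)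
open import Data.List.Relation.Unary.Any using (here; there)
open import Data.List.Relation.Unary.Unique.DecPropositional ℕ._≟_ using (unique?)
open import Data.List.Relation.Unary.Unique.Propositional using (Unique; []; _∷_)
import Data.List.Relation.Unary.Unique.Propositional.Properties as Unique
open import Data.Product using (∃; ∃₂; _×_; _,_; proj₂)
open import Function using (_∘_; id; mk⇔)
open import Relation.Binary.PropositionalEquality
  using (setoid; _≡_; _≢_; _≗_; refl; sym; trans; cong; cong₂; subst; module ≡-Reasoning)
import Data.List.Relation.Binary.Permutation.Setoid.Properties as Setoid↭
open import Relation.Nullary using (yes; no; ofʸ; ofⁿ; ¬?; contradiction)

-- Descent polynomials and the insertion of a maximal letter

xmul-cong : ∀ {p q} → p ≗ q → xmul p ≗ xmul q
xmul-cong p≗q zero    = refl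
xmul-cong p≗q (suc j) = p≗q j

xmul-⊕ : ∀ p q → xmul (p ⊕ q) ≗ xmul p ⊕ xmul q
xmul-⊕ p q zero    = refl
xmul-⊕ p q (suc j) = refl

xmul-mono : ∀ d → xmul (mono d) ≗ mono (suc d)
xmul-mono d zero    = refl
xmul-mono d (suc j) = refl

-- The coefficients of (1 + k x) p + x (1 - x) p′.
eulerianStep : ℕ → Poly → Poly
eulerianStep k p j = + suc j * p j + (+ suc k - + j) * xmul p j

private
  a*0+b*0≡0 : ∀ a b → a * + 0 + b * + 0 ≡ + 0
  a*0+b*0≡0 = solve-∀

eulerianStep-0ₚ : ∀ k → eulerianStep k 0ₚ ≗ 0ₚ
eulerianStep-0ₚ k zero    = a*0+b*0≡0 (+ 1) (+ suc k - + 0)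
eulerianStep-0ₚ k (suc j) = a*0+b*0≡0 (+ suc (suc j)) (+ suc k - + suc j)

eulerianStep-⊕ : ∀ k p q → eulerianStep k (p ⊕ q) ≗ eulerianStep k p ⊕ eulerianStep k q
eulerianStep-⊕ k p q j =
  trans (cong (λ s → + suc j * (p j + q j) + (+ suc k - + j) * s) (xmul-⊕ p q j))
        (distrib (+ suc j) (+ suc k - + j) (p j) (q j) (xmul p j) (xmul q j))
  where
  distrib : ∀ a b x y u v → a * (x + y) + b * (u + v) ≡ (a * x + b * u) + (a * y + b * v)
  distrib = solve-∀

eulerianStep-sumₚ : ∀ {A : Set} k (f : A → Poly) xs →
  eulerianStep k (sumₚ (map f xs)) ≗ sumₚ (map (eulerianStep k ∘ f) xs)
eulerianStep-sumₚ k f []       = eulerianStep-0ₚ k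
eulerianStep-sumₚ k f (x ∷ xs) j =
  trans (eulerianStep-⊕ k (f x) _ j) (cong (_+_ (eulerianStep k (f x) j)) (eulerianStep-sumₚ k f xs j))

eulerianStep-mono-zero : eulerianStep 0 (mono 0) ≗ mono 0
eulerianStep-mono-zero zero          = refl
eulerianStep-mono-zero (suc zero)    = refl
eulerianStep-mono-zero (suc (suc j)) = a*0+b*0≡0 (+ suc (suc (suc j))) (+ 1 - + suc (suc j))

eulerianStep-ascent : ∀ l d → mono (suc d) ⊕ eulerianStep l (mono d) ≗ eulerianStep (suc l) (mono d)
eulerianStep-ascent l d j rewrite xmul-mono d j =
  absorb (+ suc j) (+ suc l) (+ j) (mono d j) (mono (suc d) j)
  where
  absorb : ∀ a L J x y → y + (a * x + (L - J) * y) ≡ a * x + ((+ 1 + L) - J) * y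
  absorb = solve-∀

eulerianStep-descent : ∀ l d →
  mono (suc d) ⊕ xmul (eulerianStep l (mono d)) ≗ eulerianStep (suc l) (mono (suc d))
eulerianStep-descent l d zero    = sym (a*0+b*0≡0 (+ 1) (+ suc (suc l) - + 0))
eulerianStep-descent l d (suc i) rewrite xmul-mono d i =
  absorb (+ suc i) (+ suc l) (+ i) (mono d i) (mono (suc d) i)
  where
  absorb : ∀ a L I x y → x + (a * x + (L - I) * y) ≡ (+ 1 + a) * x + ((+ 1 + L) - (+ 1 + I)) * y
  absorb = solve-∀

des-≤ : ∀ {a b} w → a ≤ b → des (a ∷ b ∷ w) ≡ des (b ∷ w)
des-≤ {a} {b} w a≤b with b <ᵇ a | <ᵇ-reflects-< b a
... | false | _       = refl
... | true  | ofʸ b<a = contradiction a≤b (<⇒≱ b<a)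

des-> : ∀ {a b} w → b < a → des (a ∷ b ∷ w) ≡ suc (des (b ∷ w))
des-> {a} {b} w b<a with b <ᵇ a | <ᵇ-reflects-< b a
... | true  | _       = refl
... | false | ofⁿ b≮a = contradiction b<a b≮a

des-0∷ : ∀ w → des (0 ∷ w) ≡ des w
des-0∷ []      = refl
des-0∷ (b ∷ w) = des-≤ w z≤n

descentPoly : List (List ℕ) → Poly
descentPoly ws = sumₚ (map (λ w → mono (des w)) ws)

descentPoly-++ : ∀ us vs → descentPoly (us ++ vs) ≗ descentPoly us ⊕ descentPoly vs
descentPoly-++ []       vs j = sym (+-identityˡ _)
descentPoly-++ (u ∷ us) vs j =
  trans (cong (_+_ (mono (des u) j)) (descentPoly-++ us vs j)) (sym (+-assoc (mono (des u) j) _ _))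

descentPoly-concatMap : ∀ {A : Set} (f : A → List (List ℕ)) xs →
  descentPoly (concatMap f xs) ≗ sumₚ (map (descentPoly ∘ f) xs)
descentPoly-concatMap f []       j = refl
descentPoly-concatMap f (x ∷ xs) j =
  trans (descentPoly-++ (f x) _ j) (cong (_+_ (descentPoly (f x) j)) (descentPoly-concatMap f xs j))

descentPoly-↭ : ∀ {us vs} → us ↭ vs → descentPoly us ≗ descentPoly vs
descentPoly-↭ ↭.refl         j = refl
descentPoly-↭ (↭.prep u p)   j = cong (_+_ (mono (des u) j)) (descentPoly-↭ p j)
descentPoly-↭ (↭.swap u v p) j =
  trans (cong (λ s → x + (y + s)) (descentPoly-↭ p j)) (swap-+ x y _)
  where
  x = mono (des u) j
  y = mono (des v) j
  swap-+ : ∀ a b c → a + (b + c) ≡ b + (a + c)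
  swap-+ = solve-∀
descentPoly-↭ (↭.trans p q)  j = trans (descentPoly-↭ p j) (descentPoly-↭ q j)

descentPoly-map-cong : ∀ {f g : List ℕ → List ℕ} → (∀ v → des (f v) ≡ des (g v)) →
  ∀ ws → descentPoly (map f ws) ≗ descentPoly (map g ws)
descentPoly-map-cong eq []       j = refl
descentPoly-map-cong eq (w ∷ ws) j =
  cong₂ _+_ (cong (λ d → mono d j) (eq w)) (descentPoly-map-cong eq ws j)

descentPoly-map-suc : ∀ {f g : List ℕ → List ℕ} → (∀ v → des (f v) ≡ suc (des (g v))) →
  ∀ ws → descentPoly (map f ws) ≗ xmul (descentPoly (map g ws))
descentPoly-map-suc eq []       zero    = refl
descentPoly-map-suc eq []       (suc j) = refl
descentPoly-map-suc {f} {g} eq (w ∷ ws) j = begin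
  mono (des (f w)) j + descentPoly (map f ws) j
    ≡⟨ cong₂ _+_ (cong (λ d → mono d j) (eq w)) (descentPoly-map-suc eq ws j) ⟩
  mono (suc (des (g w))) j + xmul (descentPoly (map g ws)) j
    ≡⟨ cong (_+ xmul (descentPoly (map g ws)) j) (sym (xmul-mono (des (g w)) j)) ⟩
  xmul (mono (des (g w))) j + xmul (descentPoly (map g ws)) j
    ≡⟨ sym (xmul-⊕ _ _ j) ⟩
  xmul (descentPoly (map g (w ∷ ws))) j ∎
  where open ≡-Reasoning

insertions : ℕ → List ℕ → List (List ℕ)
insertions a []      = (a ∷ []) ∷ []
insertions a (b ∷ w) = (a ∷ b ∷ w) ∷ map (b ∷_) (insertions a w)

-- The prefix letter p < a is what makes the induction on w go through.
descentPoly-prefix-insertions : ∀ {a p} w → p < a → All (_< a) w →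
  descentPoly (map (p ∷_) (insertions a w)) ≗ eulerianStep (length w) (mono (des (p ∷ w)))
descentPoly-prefix-insertions {a} {p} [] p<a [] j = begin
  mono (des (p ∷ a ∷ [])) j + + 0  ≡⟨ +-identityʳ _ ⟩
  mono (des (p ∷ a ∷ [])) j        ≡⟨ cong (λ d → mono d j) (des-≤ [] (<⇒≤ p<a)) ⟩
  mono 0 j                         ≡⟨ sym (eulerianStep-mono-zero j) ⟩
  eulerianStep 0 (mono 0) j        ∎
  where open ≡-Reasoning
descentPoly-prefix-insertions {a} {p} (b ∷ w) p<a (b<a ∷ w<a) j = begin
  mono (des (p ∷ a ∷ b ∷ w)) j + descentPoly (map (p ∷_) (map (b ∷_) I)) j
    ≡⟨ cong₂ _+_ (cong (λ d → mono d j) (trans (des-≤ (b ∷ w) (<⇒≤ p<a)) (des-> w b<a)))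
                 (cong (λ ws → descentPoly ws j) (sym (map-∘ I))) ⟩
  mono (suc D) j + descentPoly (map (λ v → p ∷ b ∷ v) I) j
    ≡⟨ prefix-b ⟩
  eulerianStep (suc (length w)) (mono (des (p ∷ b ∷ w))) j ∎
  where
  open ≡-Reasoning
  I = insertions a w
  D = des (b ∷ w)
  L = length w
  IH : descentPoly (map (b ∷_) I) ≗ eulerianStep L (mono D)
  IH = descentPoly-prefix-insertions w b<a w<a
  prefix-b : mono (suc D) j + descentPoly (map (λ v → p ∷ b ∷ v) I) j ≡
             eulerianStep (suc L) (mono (des (p ∷ b ∷ w))) j
  prefix-b with b <? p
  ... | yes b<p = begin
    mono (suc D) j + descentPoly (map (λ v → p ∷ b ∷ v) I) j
      ≡⟨ cong (_+_ (mono (suc D) j)) (trans (descentPoly-map-suc (λ v → des-> v b<p) I j) (xmul-cong IH j)) ⟩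
    mono (suc D) j + xmul (eulerianStep L (mono D)) j
      ≡⟨ eulerianStep-descent L D j ⟩
    eulerianStep (suc L) (mono (suc D)) j
      ≡⟨ cong (λ d → eulerianStep (suc L) (mono d) j) (sym (des-> w b<p)) ⟩
    eulerianStep (suc L) (mono (des (p ∷ b ∷ w))) j ∎
  ... | no b≮p = begin
    mono (suc D) j + descentPoly (map (λ v → p ∷ b ∷ v) I) j
      ≡⟨ cong (_+_ (mono (suc D) j)) (trans (descentPoly-map-cong (λ v → des-≤ v (≮⇒≥ b≮p)) I j) (IH j)) ⟩
    mono (suc D) j + eulerianStep L (mono D) j
      ≡⟨ eulerianStep-ascent L D j ⟩
    eulerianStep (suc L) (mono D) j
      ≡⟨ cong (λ d → eulerianStep (suc L) (mono d) j) (sym (des-≤ w (≮⇒≥ b≮p))) ⟩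
    eulerianStep (suc L) (mono (des (p ∷ b ∷ w))) j ∎

descentPoly-insertions : ∀ {a} w → All (_< suc a) w →
  descentPoly (insertions (suc a) w) ≗ eulerianStep (length w) (mono (des w))
descentPoly-insertions {a} w w<a j = begin
  descentPoly I j               ≡⟨ cong (λ ws → descentPoly ws j) (sym (map-id I)) ⟩
  descentPoly (map id I) j      ≡⟨ descentPoly-map-cong (sym ∘ des-0∷) I j ⟩
  descentPoly (map (0 ∷_) I) j  ≡⟨ descentPoly-prefix-insertions w (s≤s z≤n) w<a j ⟩
  eulerianStep (length w) (mono (des (0 ∷ w))) j
    ≡⟨ cong (λ d → eulerianStep (length w) (mono d) j) (des-0∷ w) ⟩
  eulerianStep (length w) (mono (des w)) j ∎
  where
  open ≡-Reasoning
  I = insertions (suc a) w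

-- Permutations of [k+1] from permutations of [k]

∈-insertions⁺ : ∀ {a} u v → u ++ a ∷ v ∈ insertions a (u ++ v)
∈-insertions⁺ []      []      = here refl
∈-insertions⁺ []      (b ∷ v) = here refl
∈-insertions⁺ (b ∷ u) v       = there (∈-map⁺ (b ∷_) (∈-insertions⁺ u v))

∈-insertions⁻ : ∀ {a π} w → π ∈ insertions a w → ∃₂ λ u v → w ≡ u ++ v × π ≡ u ++ a ∷ v
∈-insertions⁻ []      (here refl) = [] , [] , refl , refl
∈-insertions⁻ (b ∷ w) (here refl) = [] , b ∷ w , refl , refl
∈-insertions⁻ (b ∷ w) (there π∈) with ∈-map⁻ (b ∷_) π∈
... | π′ , π′∈ , refl with ∈-insertions⁻ w π′∈
...   | u , v , refl , refl = b ∷ u , v , refl , refl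

insertions-↭ : ∀ {a π} w → π ∈ insertions a w → π ↭ a ∷ w
insertions-↭ {a} w π∈ with ∈-insertions⁻ w π∈
... | u , v , refl , refl = ↭-shift a u v

insertions-Unique : ∀ {a} w → a ∉ w → Unique (insertions a w)
insertions-Unique []      a∉w = [] ∷ []
insertions-Unique {a} (b ∷ w) a∉w =
  ¬Any⇒All¬ _ head∉ ∷ Unique.map⁺ ∷-injectiveʳ (insertions-Unique w (a∉w ∘ there))
  where
  head∉ : a ∷ b ∷ w ∉ map (b ∷_) (insertions a w)
  head∉ m with ∈-map⁻ (b ∷_) m
  ... | _ , _ , refl = a∉w (here refl)

remove : ℕ → List ℕ → List ℕ
remove a = filter (λ x → ¬? (a ℕ.≟ x))

remove-insertion : ∀ {a} u v → a ∉ u ++ v → remove a (u ++ a ∷ v) ≡ u ++ v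
remove-insertion {a} u v a∉ = begin
  remove a (u ++ a ∷ v)           ≡⟨ filter-++ keep? u (a ∷ v) ⟩
  remove a u ++ remove a (a ∷ v)  ≡⟨ cong₂ _++_ (filter-all keep? u-kept)
                                               (filter-reject keep? {xs = v} λ a≢a → a≢a refl) ⟩
  u ++ remove a v                 ≡⟨ cong (u ++_) (filter-all keep? v-kept) ⟩
  u ++ v                          ∎
  where
  open ≡-Reasoning
  keep? = λ x → ¬? (a ℕ.≟ x)
  u-kept = ++⁻ˡ u (¬Any⇒All¬ (u ++ v) a∉)
  v-kept = ++⁻ʳ u (¬Any⇒All¬ (u ++ v) a∉)

insertions-remove : ∀ {a π} w → a ∉ w → π ∈ insertions a w → remove a π ≡ w
insertions-remove w a∉w π∈ with ∈-insertions⁻ w π∈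
... | u , v , refl , refl = remove-insertion u v a∉w

concatMap-Unique : ∀ {A B : Set} (f : A → List B) {xs} → Unique xs →
  (∀ {x} → x ∈ xs → Unique (f x)) →
  (∀ {x y z} → x ∈ xs → y ∈ xs → z ∈ f x → z ∈ f y → x ≡ y) →
  Unique (concatMap f xs)
concatMap-Unique f {[]}     _          _       _   = []
concatMap-Unique f {x ∷ xs} (x∉ ∷ uxs) uniqueF inj =
  Unique.++⁺ (uniqueF (here refl))
             (concatMap-Unique f uxs (uniqueF ∘ there) (λ x∈ y∈ → inj (there x∈) (there y∈)))
             disjoint
  where
  disjoint : Disjoint (f x) (concatMap f xs)
  disjoint (z∈fx , z∈rest) with find (∈-concatMap⁻ f z∈rest)
  ... | y , y∈xs , z∈fy = All.lookup x∉ y∈xs (inj (here refl) (there y∈xs) z∈fx z∈fy)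

Unique-↭ : ∀ {A : Set} {xs ys : List A} → xs ↭ ys → Unique xs → Unique ys
Unique-↭ {A} = Setoid↭.Unique-resp-↭ (setoid A) ∘ ↭⇒↭ₛ

pigeonhole : ∀ {xs ys : List ℕ} → Unique xs → Unique ys → (∀ {x} → x ∈ xs → x ∈ ys) →
  length xs ≤ length ys
pigeonhole {xs} {ys} uxs uys xs⊆ys =
  ℕ.≤-trans (ℕ.≤-reflexive (↭-length xs↭common)) (length-filter (_∈? xs) ys)
  where
  xs↭common : xs ↭ filter (_∈? xs) ys
  xs↭common = ∼bag⇒↭ (unique∧set⇒bag uxs (Unique.filter⁺ (_∈? xs) {ys} uys)
    (mk⇔ (λ x∈ → ∈-filter⁺ (_∈? xs) (xs⊆ys x∈) x∈) (proj₂ ∘ ∈-filter⁻ (_∈? xs) {xs = ys})))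

letters : ℕ → List ℕ
letters m = applyUpTo suc m

∈-letters-< : ∀ {m x} → x ∈ letters m → x < suc m
∈-letters-< x∈ with ∈-applyUpTo⁻ suc x∈
... | i , i<m , refl = s≤s i<m

∈-letters-suc⁺ : ∀ {m x} → x ∈ letters m → x ∈ letters (suc m)
∈-letters-suc⁺ x∈ with ∈-applyUpTo⁻ suc x∈
... | i , i<m , refl = ∈-applyUpTo⁺ suc (ℕ.m<n⇒m<1+n i<m)

∈-letters-suc⁻ : ∀ {m x} → x ∈ letters (suc m) → x ≢ suc m → x ∈ letters m
∈-letters-suc⁻ x∈ x≢ with ∈-applyUpTo⁻ suc x∈
... | i , i<1+m , refl = ∈-applyUpTo⁺ suc (ℕ.≤∧≢⇒< (ℕ.≤-pred i<1+m) (x≢ ∘ cong suc))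

suc-∈-letters : ∀ m → suc m ∈ letters (suc m)
suc-∈-letters m = ∈-applyUpTo⁺ suc (ℕ.n<1+n m)

suc∉letters : ∀ {m w} → All (_∈ letters m) w → suc m ∉ w
suc∉letters w⊆ m∈w = ℕ.<-irrefl refl (∈-letters-< (All.lookup w⊆ m∈w))

letters-Unique : ∀ m → Unique (letters m)
letters-Unique m = Unique.applyUpTo⁺₁ suc m (λ i<j _ → ℕ.<⇒≢ i<j ∘ ℕ.suc-injective)

∈-words⁺ : ∀ {m} π → All (_∈ letters m) π → π ∈ words m (length π)
∈-words⁺ []      []        = here refl
∈-words⁺ (x ∷ π) (x∈ ∷ π⊆) =
  ∈-concatMap⁺ (λ w → map (_∷ w) (letters _)) (lose (∈-words⁺ π π⊆) (∈-map⁺ (_∷ π) x∈))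

∈-words⁻ : ∀ {m π} len → π ∈ words m len → length π ≡ len × All (_∈ letters m) π
∈-words⁻ zero          (here refl) = refl , []
∈-words⁻ {m} (suc len) π∈ with find (∈-concatMap⁻ (λ w → map (_∷ w) (letters m)) {words m len} π∈)
... | w , w∈ , π∈w with ∈-map⁻ (_∷ w) π∈w
...   | x , x∈ , refl with ∈-words⁻ len w∈
...     | w-length , w⊆ = cong suc w-length , x∈ ∷ w⊆

words-Unique : ∀ m len → Unique (words m len)
words-Unique m zero      = [] ∷ []
words-Unique m (suc len) =
  concatMap-Unique (λ w → map (_∷ w) (letters m)) (words-Unique m len)
    (λ _ → Unique.map⁺ ∷-injectiveˡ (letters-Unique m))
    (λ _ _ z∈x z∈y → same-tail (∈-map⁻ (_∷ _) z∈x) (∈-map⁻ (_∷ _) z∈y))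
  where
  same-tail : ∀ {x y z : List ℕ} →
    ∃ (λ a → a ∈ letters m × z ≡ a ∷ x) → ∃ (λ b → b ∈ letters m × z ≡ b ∷ y) → x ≡ y
  same-tail (_ , _ , refl) (_ , _ , refl) = refl

record IsPermutation (m : ℕ) (π : List ℕ) : Set where
  field
    length≡  : length π ≡ m
    letters⊆ : All (_∈ letters m) π
    unique   : Unique π

open IsPermutation

∈-perms⁺ : ∀ {m π} → IsPermutation m π → π ∈ perms m
∈-perms⁺ {m} {π} P =
  ∈-filter⁺ unique? (subst (λ l → π ∈ words m l) (length≡ P) (∈-words⁺ π (letters⊆ P))) (unique P)

∈-perms⁻ : ∀ {m π} → π ∈ perms m → IsPermutation m π
∈-perms⁻ {m} π∈ with ∈-filter⁻ unique? π∈
... | π∈words , π-unique with ∈-words⁻ m π∈words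
...   | π-length , π⊆ = record { length≡ = π-length ; letters⊆ = π⊆ ; unique = π-unique }

perms-Unique : ∀ m → Unique (perms m)
perms-Unique m = Unique.filter⁺ unique? (words-Unique m m)

IsPermutation-insert : ∀ {k π w} → π ↭ suc k ∷ w → IsPermutation k w → IsPermutation (suc k) π
IsPermutation-insert {k} {π} {w} π↭ W = record
  { length≡  = trans (↭-length π↭) (cong suc (length≡ W))
  ; letters⊆ = All.tabulate (letter ∘ ∈-resp-↭ π↭)
  ; unique   = Unique-↭ (↭-sym π↭) (¬Any⇒All¬ w (suc∉letters (letters⊆ W)) ∷ unique W)
  }
  where
  letter : ∀ {x} → x ∈ suc k ∷ w → x ∈ letters (suc k)
  letter (here refl) = suc-∈-letters k
  letter (there x∈w) = ∈-letters-suc⁺ (All.lookup (letters⊆ W) x∈w)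

IsPermutation-remove : ∀ {k π w} → π ↭ suc k ∷ w → IsPermutation (suc k) π → IsPermutation k w
IsPermutation-remove {k} {π} {w} π↭ P with Unique-↭ π↭ (unique P)
... | k∉w ∷ w-unique = record
  { length≡  = ℕ.suc-injective (trans (sym (↭-length π↭)) (length≡ P))
  ; letters⊆ = All.tabulate letter
  ; unique   = w-unique
  }
  where
  letter : ∀ {x} → x ∈ w → x ∈ letters k
  letter x∈w = ∈-letters-suc⁻ (All.lookup (letters⊆ P) (∈-resp-↭ (↭-sym π↭) (there x∈w)))
                               (All.lookup k∉w x∈w ∘ sym)

IsPermutation⇒max∈ : ∀ {k π} → IsPermutation (suc k) π → suc k ∈ π
IsPermutation⇒max∈ {k} {π} P with suc k ∈? π
... | yes k∈π = k∈π
... | no  k∉π = contradiction (subst (_≤ k) (length≡ P) π-short) (ℕ.n≮n k)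
  where
  π-short : length π ≤ k
  π-short = ℕ.≤-trans
    (pigeonhole (unique P) (letters-Unique k)
      (λ x∈π → ∈-letters-suc⁻ (All.lookup (letters⊆ P) x∈π) (λ { refl → k∉π x∈π })))
    (ℕ.≤-reflexive (length-applyUpTo suc k))

perms-suc-↭ : ∀ k → perms (suc k) ↭ concatMap (insertions (suc k)) (perms k)
perms-suc-↭ k = ∼bag⇒↭ (unique∧set⇒bag (perms-Unique (suc k)) inserted-Unique (mk⇔ to from))
  where
  k∉ : ∀ {w} → w ∈ perms k → suc k ∉ w
  k∉ = suc∉letters ∘ letters⊆ ∘ ∈-perms⁻

  inserted-Unique : Unique (concatMap (insertions (suc k)) (perms k))
  inserted-Unique = concatMap-Unique (insertions (suc k)) (perms-Unique k)
    (λ w∈ → insertions-Unique _ (k∉ w∈))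
    (λ x∈ y∈ z∈x z∈y → trans (sym (insertions-remove _ (k∉ x∈) z∈x)) (insertions-remove _ (k∉ y∈) z∈y))

  to : ∀ {π} → π ∈ perms (suc k) → π ∈ concatMap (insertions (suc k)) (perms k)
  to π∈ with ∈-∃++ (IsPermutation⇒max∈ {k} (∈-perms⁻ π∈))
  ... | u , v , refl = ∈-concatMap⁺ (insertions (suc k))
    (lose (∈-perms⁺ (IsPermutation-remove (↭-shift (suc k) u v) (∈-perms⁻ π∈))) (∈-insertions⁺ u v))

  from : ∀ {π} → π ∈ concatMap (insertions (suc k)) (perms k) → π ∈ perms (suc k)
  from π∈ with find (∈-concatMap⁻ (insertions (suc k)) {perms k} π∈)
  ... | w , w∈ , π∈w = ∈-perms⁺ (IsPermutation-insert (insertions-↭ w π∈w) (∈-perms⁻ w∈))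

sumₚ-map-cong-∈ : ∀ {A : Set} {f g : A → Poly} xs → (∀ {x} → x ∈ xs → f x ≗ g x) →
  sumₚ (map f xs) ≗ sumₚ (map g xs)
sumₚ-map-cong-∈ []       f≗g j = refl
sumₚ-map-cong-∈ (x ∷ xs) f≗g j = cong₂ _+_ (f≗g (here refl) j) (sumₚ-map-cong-∈ xs (f≗g ∘ there) j)

eulerian-suc : ∀ k → eulerian (suc k) ≗ eulerianStep k (eulerian k)
eulerian-suc k j = begin
  descentPoly (perms (suc k)) j
    ≡⟨ descentPoly-↭ (perms-suc-↭ k) j ⟩
  descentPoly (concatMap (insertions (suc k)) (perms k)) j
    ≡⟨ descentPoly-concatMap (insertions (suc k)) (perms k) j ⟩
  sumₚ (map (descentPoly ∘ insertions (suc k)) (perms k)) j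
    ≡⟨ sumₚ-map-cong-∈ (perms k) inserted j ⟩
  sumₚ (map (eulerianStep k ∘ mono ∘ des) (perms k)) j
    ≡⟨ sym (eulerianStep-sumₚ k (mono ∘ des) (perms k) j) ⟩
  eulerianStep k (eulerian k) j ∎
  where
  open ≡-Reasoning
  inserted : ∀ {w} → w ∈ perms k → descentPoly (insertions (suc k) w) ≗ eulerianStep k (mono (des w))
  inserted {w} w∈ i = trans (descentPoly-insertions w (All.map ∈-letters-< (letters⊆ W)) i)
                            (cong (λ l → eulerianStep l (mono (des w)) i) (length≡ W))
    where W = ∈-perms⁻ w∈

-- Binomial sums

[k+1]*[n+1]C[k+1]≡[n+1]*nCk : ∀ n k → suc k ℕ.* (suc n C suc k) ≡ suc n ℕ.* (n C k)
[k+1]*[n+1]C[k+1]≡[n+1]*nCk n       zero    =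
  trans (ℕ.*-identityˡ _) (trans (nC1≡n (suc n)) (sym (ℕ.*-identityʳ (suc n))))
[k+1]*[n+1]C[k+1]≡[n+1]*nCk zero    (suc k) = ℕ.*-zeroʳ (suc (suc k))
[k+1]*[n+1]C[k+1]≡[n+1]*nCk (suc n) (suc k) = begin
  suc (suc k) ℕ.* (suc (suc n) C suc (suc k))
    ≡⟨ cong (suc (suc k) ℕ.*_) (sym (nCk+nC[k+1]≡[n+1]C[k+1] (suc n) (suc k))) ⟩
  suc (suc k) ℕ.* (a ℕ.+ b)
    ≡⟨ split k a b ⟩
  a ℕ.+ suc k ℕ.* a ℕ.+ suc (suc k) ℕ.* b
    ≡⟨ cong₂ (λ x y → a ℕ.+ x ℕ.+ y) ([k+1]*[n+1]C[k+1]≡[n+1]*nCk n k)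
                                       ([k+1]*[n+1]C[k+1]≡[n+1]*nCk n (suc k)) ⟩
  a ℕ.+ suc n ℕ.* (n C k) ℕ.+ suc n ℕ.* (n C suc k)
    ≡⟨ merge a (suc n) (n C k) (n C suc k) ⟩
  a ℕ.+ suc n ℕ.* (n C k ℕ.+ n C suc k)
    ≡⟨ cong (λ x → a ℕ.+ suc n ℕ.* x) (nCk+nC[k+1]≡[n+1]C[k+1] n k) ⟩
  suc (suc n) ℕ.* a ∎
  where
  open ≡-Reasoning
  a = suc n C suc k
  b = suc n C suc (suc k)
  split : ∀ k a b → (2 ℕ.+ k) ℕ.* (a ℕ.+ b) ≡ a ℕ.+ (1 ℕ.+ k) ℕ.* a ℕ.+ (2 ℕ.+ k) ℕ.* b
  split = ℕ-solve-∀
  merge : ∀ a m x y → a ℕ.+ m ℕ.* x ℕ.+ m ℕ.* y ≡ a ℕ.+ m ℕ.* (x ℕ.+ y)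
  merge = ℕ-solve-∀

binomialSum : ℕ → (ℕ → ℤ) → ℤ
binomialSum n f = ∑[ k ≤ n ] (+ (n C toℕ k) * f (toℕ k))

binomialSum-cong : ∀ n {f g} → (∀ k → f k ≡ g k) → binomialSum n f ≡ binomialSum n g
binomialSum-cong n f≡g = sum-cong-≗ {suc n} (λ k → cong (_*_ (+ (n C toℕ k))) (f≡g (toℕ k)))

binomialSum-+ : ∀ n f g → binomialSum n (λ k → f k + g k) ≡ binomialSum n f + binomialSum n g
binomialSum-+ n f g =
  trans (sum-cong-≗ {suc n} (λ k → ℤ.*-distribˡ-+ (+ (n C toℕ k)) (f (toℕ k)) (g (toℕ k))))
        (∑-distrib-+ {suc n} (λ k → + (n C toℕ k) * f (toℕ k)) (λ k → + (n C toℕ k) * g (toℕ k)))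

binomialSum-* : ∀ n c f → binomialSum n (λ k → c * f k) ≡ c * binomialSum n f
binomialSum-* n c f =
  trans (sum-cong-≗ {suc n} (λ k → swap-* (+ (n C toℕ k)) c (f (toℕ k))))
        (sym (*-distribˡ-sum {suc n} c (λ k → + (n C toℕ k) * f (toℕ k))))
  where
  swap-* : ∀ a b x → a * (b * x) ≡ b * (a * x)
  swap-* = solve-∀

binomialSum-suc : ∀ n f → binomialSum (suc n) f ≡ binomialSum n f + binomialSum n (f ∘ suc)
binomialSum-suc n f = begin
  + 1 * f 0 + ∑[ k ≤ n ] (+ (suc n C suc (toℕ k)) * f (suc (toℕ k)))
    ≡⟨ cong (_+_ (+ 1 * f 0)) (trans (sum-cong-≗ {suc n} pascal)
                                     (∑-distrib-+ {suc n} (λ k → + (n C toℕ k) * f (suc (toℕ k))) (g ∘ toℕ))) ⟩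
  + 1 * f 0 + (binomialSum n (f ∘ suc) + ∑[ k ≤ n ] g (toℕ k))
    ≡⟨ cong (λ s → + 1 * f 0 + (binomialSum n (f ∘ suc) + s)) (sum-init-last {n} (g ∘ toℕ)) ⟩
  + 1 * f 0 + (binomialSum n (f ∘ suc) + (∑[ k < n ] g (toℕ (inject₁ k)) + g (toℕ (fromℕ n))))
    ≡⟨ cong₂ (λ s r → + 1 * f 0 + (binomialSum n (f ∘ suc) + (s + r)))
             (sum-cong-≗ {n} (cong g ∘ toℕ-inject₁)) (trans (cong g (toℕ-fromℕ n)) g-last) ⟩
  + 1 * f 0 + (binomialSum n (f ∘ suc) + (∑[ k < n ] g (toℕ k) + + 0))
    ≡⟨ regroup (+ 1 * f 0) (binomialSum n (f ∘ suc)) (∑[ k < n ] g (toℕ k)) ⟩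
  binomialSum n f + binomialSum n (f ∘ suc) ∎
  where
  open ≡-Reasoning
  g : ℕ → ℤ
  g i = + (n C suc i) * f (suc i)
  pascal : ∀ k → + (suc n C suc (toℕ k)) * f (suc (toℕ k)) ≡ + (n C toℕ k) * f (suc (toℕ k)) + g (toℕ k)
  pascal k = begin
    + (suc n C suc i) * f (suc i)
      ≡⟨ cong (λ c → + c * f (suc i)) (sym (nCk+nC[k+1]≡[n+1]C[k+1] n i)) ⟩
    + (n C i ℕ.+ n C suc i) * f (suc i)
      ≡⟨ cong (_* f (suc i)) (ℤ.pos-+ (n C i) (n C suc i)) ⟩
    (+ (n C i) + + (n C suc i)) * f (suc i)
      ≡⟨ ℤ.*-distribʳ-+ (f (suc i)) (+ (n C i)) (+ (n C suc i)) ⟩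
    + (n C i) * f (suc i) + g i ∎
    where i = toℕ k
  g-last : g n ≡ + 0
  g-last = cong (λ c → + c * f (suc n)) (k>n⇒nCk≡0 (ℕ.n<1+n n))
  regroup : ∀ a x y → a + (x + (y + + 0)) ≡ (a + y) + x
  regroup = solve-∀

binomialSum-absorb : ∀ n f → binomialSum (suc n) (λ k → + k * f k) ≡ + suc n * binomialSum n (f ∘ suc)
binomialSum-absorb n f = begin
  + 1 * (+ 0 * f 0) + ∑[ k ≤ n ] (+ (suc n C suc (toℕ k)) * (+ suc (toℕ k) * f (suc (toℕ k))))
    ≡⟨ trans (+-identityˡ _) (sum-cong-≗ {suc n} (absorb ∘ toℕ)) ⟩
  ∑[ k ≤ n ] (+ suc n * (+ (n C toℕ k) * f (suc (toℕ k))))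
    ≡⟨ sym (*-distribˡ-sum {suc n} (+ suc n) (λ k → + (n C toℕ k) * f (suc (toℕ k)))) ⟩
  + suc n * binomialSum n (f ∘ suc) ∎
  where
  open ≡-Reasoning
  absorb : ∀ i → + (suc n C suc i) * (+ suc i * f (suc i)) ≡ + suc n * (+ (n C i) * f (suc i))
  absorb i = begin
    + (suc n C suc i) * (+ suc i * f (suc i))
      ≡⟨ swap-* (+ (suc n C suc i)) (+ suc i) (f (suc i)) ⟩
    (+ suc i * + (suc n C suc i)) * f (suc i)
      ≡⟨ cong (_* f (suc i)) (sym (ℤ.pos-* (suc i) (suc n C suc i))) ⟩
    + (suc i ℕ.* (suc n C suc i)) * f (suc i)
      ≡⟨ cong (λ c → + c * f (suc i)) ([k+1]*[n+1]C[k+1]≡[n+1]*nCk n i) ⟩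
    + (suc n ℕ.* (n C i)) * f (suc i)
      ≡⟨ cong (_* f (suc i)) (ℤ.pos-* (suc n) (n C i)) ⟩
    (+ suc n * + (n C i)) * f (suc i)
      ≡⟨ ℤ.*-assoc (+ suc n) (+ (n C i)) (f (suc i)) ⟩
    + suc n * (+ (n C i) * f (suc i)) ∎
    where
    swap-* : ∀ a b x → a * (b * x) ≡ (b * a) * x
    swap-* = solve-∀

binomialSum-recurrence : ∀ (c : ℤ) (e e′ : ℕ → ℤ) →
  (∀ k → e (suc k) ≡ (+ 1 + c) * e k + (+ suc k - c) * e′ k) → ∀ m →
  binomialSum (suc (suc m)) e ≡
    (+ 2 + c) * binomialSum (suc m) e + (+ suc (suc m) - c) * binomialSum (suc m) e′
    - + suc m * binomialSum m e′
binomialSum-recurrence c e e′ e-rec m = begin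
  binomialSum (suc (suc m)) e
    ≡⟨ binomialSum-suc (suc m) e ⟩
  S + binomialSum (suc m) (e ∘ suc)
    ≡⟨ cong (_+_ S) shifted ⟩
  S + ((+ 1 + c) * S + (+ 1 - c) * S′ + + suc m * U)
    ≡⟨ cong (λ s → S + ((+ 1 + c) * S + (+ 1 - c) * s + + suc m * U)) S′-split ⟩
  S + ((+ 1 + c) * S + (+ 1 - c) * (T′ + U) + + suc m * U)
    ≡⟨ collect c (+ m) S T′ U ⟩
  (+ 2 + c) * S + (+ suc (suc m) - c) * (T′ + U) - + suc m * T′
    ≡⟨ cong (λ s → (+ 2 + c) * S + (+ suc (suc m) - c) * s - + suc m * T′) (sym S′-split) ⟩
  (+ 2 + c) * S + (+ suc (suc m) - c) * S′ - + suc m * T′ ∎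
  where
  open ≡-Reasoning
  S  = binomialSum (suc m) e
  S′ = binomialSum (suc m) e′
  T′ = binomialSum m e′
  U  = binomialSum m (e′ ∘ suc)
  S′-split : S′ ≡ T′ + U
  S′-split = binomialSum-suc m e′
  split-index : ∀ c k x y → (+ 1 + c) * x + ((+ 1 + k) - c) * y ≡ ((+ 1 + c) * x + (+ 1 - c) * y) + k * y
  split-index = solve-∀
  shifted : binomialSum (suc m) (e ∘ suc) ≡ (+ 1 + c) * S + (+ 1 - c) * S′ + + suc m * U
  shifted = begin
    binomialSum (suc m) (e ∘ suc)
      ≡⟨ binomialSum-cong (suc m) (λ k → trans (e-rec k) (split-index c (+ k) (e k) (e′ k))) ⟩
    binomialSum (suc m) (λ k → ((+ 1 + c) * e k + (+ 1 - c) * e′ k) + + k * e′ k)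
      ≡⟨ binomialSum-+ (suc m) (λ k → (+ 1 + c) * e k + (+ 1 - c) * e′ k) (λ k → + k * e′ k) ⟩
    binomialSum (suc m) (λ k → (+ 1 + c) * e k + (+ 1 - c) * e′ k) + binomialSum (suc m) (λ k → + k * e′ k)
      ≡⟨ cong₂ _+_ (trans (binomialSum-+ (suc m) (λ k → (+ 1 + c) * e k) (λ k → (+ 1 - c) * e′ k))
                          (cong₂ _+_ (binomialSum-* (suc m) (+ 1 + c) e) (binomialSum-* (suc m) (+ 1 - c) e′)))
                   (binomialSum-absorb m e′) ⟩
    (+ 1 + c) * S + (+ 1 - c) * S′ + + suc m * U ∎
  collect : ∀ c M s t u →
    s + ((+ 1 + c) * s + (+ 1 - c) * (t + u) + (+ 1 + M) * u) ≡
    (+ 2 + c) * s + ((+ 2 + M) - c) * (t + u) - (+ 1 + M) * t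
  collect = solve-∀

-- Binomial-Eulerian polynomials

eulerianBinomialSum : ℕ → Poly
eulerianBinomialSum n j = binomialSum n (λ k → eulerian k j)

xmul-eulerianBinomialSum : ∀ n j →
  xmul (eulerianBinomialSum n) j ≡ binomialSum n (λ k → xmul (eulerian k) j)
-- + 0 * x computes to + 0, so the case j = 0 is binomialSum-* with c = + 0.
xmul-eulerianBinomialSum n zero    = sym (binomialSum-* n (+ 0) (λ _ → + 0))
xmul-eulerianBinomialSum n (suc j) = refl

eulerianBinomialSum-recurrence : ∀ m j →
  eulerianBinomialSum (suc (suc m)) j ≡
    (+ 2 + + j) * eulerianBinomialSum (suc m) j
    + (+ suc (suc m) - + j) * xmul (eulerianBinomialSum (suc m)) j
    - + suc m * xmul (eulerianBinomialSum m) j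
eulerianBinomialSum-recurrence m j =
  trans (binomialSum-recurrence (+ j) (λ k → eulerian k j) (λ k → xmul (eulerian k) j)
                                (λ k → eulerian-suc k j) m)
        (cong₂ (λ y z → (+ 2 + + j) * eulerianBinomialSum (suc m) j + (+ suc (suc m) - + j) * y - + suc m * z)
               (sym (xmul-eulerianBinomialSum (suc m) j)) (sym (xmul-eulerianBinomialSum m j)))

sumₚ-applyUpTo : ∀ (h : ℕ → Poly) g N j → sumₚ (map h (applyUpTo g N)) j ≡ ∑[ k < N ] h (g (toℕ k)) j
sumₚ-applyUpTo h g zero    j = refl
sumₚ-applyUpTo h g (suc N) j = cong (_+_ (h (g 0) j)) (sumₚ-applyUpTo h (g ∘ suc) N j)

binEulerian-zero : ∀ n → binEulerian n 0 ≡ + 1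
binEulerian-zero zero    = refl
binEulerian-zero (suc n) = refl

private
  cancel : ∀ e s → s ≡ (+ 1 * e + s) - e
  cancel = solve-∀

binEulerian-suc : ∀ n j → binEulerian n (suc j) ≡ eulerianBinomialSum n j - eulerian 0 j
binEulerian-suc zero    j = cancel (eulerian 0 j) (+ 0)
binEulerian-suc (suc n) j = begin
  + 0 + sumₚ (map (λ k → (suc n C k) ·ₚ eulerian k) (applyUpTo suc (suc n))) j
    ≡⟨ trans (+-identityˡ _) (sumₚ-applyUpTo (λ k → (suc n C k) ·ₚ eulerian k) suc (suc n) j) ⟩
  ∑[ k < suc n ] (+ (suc n C suc (toℕ k)) * eulerian (suc (toℕ k)) j)
    ≡⟨ cancel (eulerian 0 j) _ ⟩
  eulerianBinomialSum (suc n) j - eulerian 0 j ∎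
  where open ≡-Reasoning

eulerian₀-constant : ∀ j → + j * eulerian 0 j ≡ + 0
eulerian₀-constant zero    = refl
eulerian₀-constant (suc j) = ℤ.*-zeroʳ (+ suc j)

binEulerian-recurrence : ∀ m j →
  binEulerian (suc (suc m)) j ≡
    (+ j + + 1) * binEulerian (suc m) j + (+ suc m - + j + + 2) * xmul (binEulerian (suc m)) j
    - + suc m * xmul (binEulerian m) j
binEulerian-recurrence m zero = begin
  binEulerian (suc (suc m)) 0  ≡⟨ binEulerian-zero (suc (suc m)) ⟩
  + 1                          ≡⟨ constant (+ suc m - + 0 + + 2) (+ suc m) ⟩
  (+ 0 + + 1) * + 1 + (+ suc m - + 0 + + 2) * + 0 - + suc m * + 0
    ≡⟨ cong (λ x → (+ 0 + + 1) * x + (+ suc m - + 0 + + 2) * + 0 - + suc m * + 0)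
            (sym (binEulerian-zero (suc m))) ⟩
  (+ 0 + + 1) * binEulerian (suc m) 0 + (+ suc m - + 0 + + 2) * + 0 - + suc m * + 0 ∎
  where
  open ≡-Reasoning
  constant : ∀ b c → + 1 ≡ (+ 0 + + 1) * + 1 + b * + 0 - c * + 0
  constant = solve-∀
binEulerian-recurrence m (suc zero) = begin
  binEulerian (suc (suc m)) 1
    ≡⟨ binEulerian-suc (suc (suc m)) 0 ⟩
  eulerianBinomialSum (suc (suc m)) 0 - + 1
    ≡⟨ cong (_- + 1) (eulerianBinomialSum-recurrence m 0) ⟩
  (+ 2 + + 0) * B + (+ suc (suc m) - + 0) * + 0 - + suc m * + 0 - + 1
    ≡⟨ linear (+ m) B ⟩
  R (B - + 1) (+ 1) (+ 1)
    ≡⟨ cong₂ (λ x y → R x y (+ 1)) (sym (binEulerian-suc (suc m) 0)) (sym (binEulerian-zero (suc m))) ⟩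
  R (binEulerian (suc m) 1) (binEulerian (suc m) 0) (+ 1)
    ≡⟨ cong (R (binEulerian (suc m) 1) (binEulerian (suc m) 0)) (sym (binEulerian-zero m)) ⟩
  R (binEulerian (suc m) 1) (binEulerian (suc m) 0) (binEulerian m 0) ∎
  where
  open ≡-Reasoning
  B = eulerianBinomialSum (suc m) 0
  R : ℤ → ℤ → ℤ → ℤ
  R x y z = (+ 1 + + 1) * x + (+ suc m - + 1 + + 2) * y - + suc m * z
  linear : ∀ M b → (+ 2 + + 0) * b + ((+ 2 + M) - + 0) * + 0 - (+ 1 + M) * + 0 - + 1 ≡
                   (+ 1 + + 1) * (b - + 1) + ((+ 1 + M) - + 1 + + 2) * + 1 - (+ 1 + M) * + 1
  linear = solve-∀
binEulerian-recurrence m (suc (suc i)) = begin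
  binEulerian (suc (suc m)) (suc (suc i))
    ≡⟨ binEulerian-suc (suc (suc m)) (suc i) ⟩
  eulerianBinomialSum (suc (suc m)) (suc i) - + 0
    ≡⟨ cong (_- + 0) (eulerianBinomialSum-recurrence m (suc i)) ⟩
  (+ 2 + + suc i) * X + (+ suc (suc m) - + suc i) * Y - + suc m * Z - + 0
    ≡⟨ regroup (+ i) (+ m) X Y Z e ⟩
  R (X - + 0) (Y - e) (Z - e) - + i * e
    ≡⟨ cong (λ t → R (X - + 0) (Y - e) (Z - e) - t) (eulerian₀-constant i) ⟩
  R (X - + 0) (Y - e) (Z - e) - + 0
    ≡⟨ +-identityʳ _ ⟩
  R (X - + 0) (Y - e) (Z - e)
    ≡⟨ cong₂ (λ x y → R x y (Z - e)) (sym (binEulerian-suc (suc m) (suc i))) (sym (binEulerian-suc (suc m) i)) ⟩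
  R (binEulerian (suc m) (suc (suc i))) (binEulerian (suc m) (suc i)) (Z - e)
    ≡⟨ cong (R (binEulerian (suc m) (suc (suc i))) (binEulerian (suc m) (suc i))) (sym (binEulerian-suc m i)) ⟩
  R (binEulerian (suc m) (suc (suc i))) (binEulerian (suc m) (suc i)) (binEulerian m (suc i)) ∎
  where
  open ≡-Reasoning
  X = eulerianBinomialSum (suc m) (suc i)
  Y = eulerianBinomialSum (suc m) i
  Z = eulerianBinomialSum m i
  e = eulerian 0 i
  R : ℤ → ℤ → ℤ → ℤ
  R x y z = (+ suc (suc i) + + 1) * x + (+ suc m - + suc (suc i) + + 2) * y - + suc m * z
  regroup : ∀ I M x y z e →
    (+ 2 + (+ 1 + I)) * x + ((+ 2 + M) - (+ 1 + I)) * y - (+ 1 + M) * z - + 0 ≡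
    ((+ 2 + I) + + 1) * (x - + 0) + ((+ 1 + M) - (+ 2 + I) + + 2) * (y - e) - (+ 1 + M) * (z - e) - I * e
  regroup = solve-∀

coeff-pred : ∀ p j → coeff p (+ j - + 1) ≡ xmul p j
coeff-pred p zero    = refl
coeff-pred p (suc j) = refl

theorem2p1 : (n : ℕ) → 1 ≤ n → (k : ℤ) →
  Ã (suc n) k ≡
    (k + + 1) * Ã n k + (+ n - k + + 2) * Ã n (k - + 1) - + n * Ã (n ∸ 1) (k - + 1)
theorem2p1 (suc m) _ -[1+ t ] = vanish (-[1+ t ] + + 1) (+ suc m - -[1+ t ] + + 2) (+ suc m)
  where
  vanish : ∀ a b c → + 0 ≡ a * + 0 + b * + 0 - c * + 0
  vanish = solve-∀
theorem2p1 (suc m) _ (+ j) =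
  trans (binEulerian-recurrence m j)
        (cong₂ (λ y z → (+ j + + 1) * binEulerian (suc m) j + (+ suc m - + j + + 2) * y - + suc m * z)
               (sym (coeff-pred (binEulerian (suc m)) j)) (sym (coeff-pred (binEulerian m) j)))
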